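{- Let $\mathcal{T}$ be a set of $n$ points in $\mathbb{E}^3$ and $n'$ an integer such that no more than $n'$ points of $\mathcal{T}$ lie on any plane or on the union of any pair of lines. Let $k \ge 0$ be an integer and suppose $\mathcal{L} \subset \mathcal{T}$ is a set of at least $n'-k$ points all lying on a line $\ell$. Then (1) no subset of $\mathcal{T} \setminus \mathcal{L}$ with more than $k$ points is collinear, and (2) no subset of $\mathcal{T} \setminus \mathcal{L}$ with more than $k$ points lies on a plane containing $\ell$. -}

module Defs where

open import Level using (Level; _⊔_)
open import Algebra.Bundles using (CommutativeRing)
open import Data.Product using (Σ; ∃; ∃₂; _×_; _,_)
open import Data.List using (List; length)
open import Data.List.Relation.Unary.All using (All)
open import Relation.Nullary using (¬_)
open import Relation.Binary.Bundles using (Setoid)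
open import Data.Product.Relation.Binary.Pointwise.NonDependent using (×-setoid)
import Data.List.Membership.Setoid as SetoidMembership
import Data.List.Relation.Unary.Unique.Setoid as SetoidUnique

record Field (c ℓ : Level) : Set (Level.suc (c ⊔ ℓ)) where
  field
    commutativeRing : CommutativeRing c ℓ
  open CommutativeRing commutativeRing public
  field
    0≉1     : ¬ (0# ≈ 1#)
    inverse : ∀ x → ¬ (x ≈ 0#) → ∃ λ y → (x * y) ≈ 1#

module Geometry {c ℓ : Level} (F : Field c ℓ) where
  open Field F

  Point : Set c
  Point = Carrier × Carrier × Carrier

  PointSetoid : Setoid c ℓ
  PointSetoid = ×-setoid setoid (×-setoid setoid setoid)

  _≈ₚ_ : Point → Point → Set ℓ
  _≈ₚ_ = Setoid._≈_ PointSetoid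

  _⊕_ : Point → Point → Point
  (a₁ , a₂ , a₃) ⊕ (b₁ , b₂ , b₃) = (a₁ + b₁ , a₂ + b₂ , a₃ + b₃)

  _·_ : Carrier → Point → Point
  t · (a₁ , a₂ , a₃) = (t * a₁ , t * a₂ , t * a₃)

  𝟎 : Point
  𝟎 = (0# , 0# , 0#)

  record Line : Set (c ⊔ ℓ) where
    field
      base      : Point
      dir       : Point
      dir≉0     : ¬ (dir ≈ₚ 𝟎)

  OnLine : Point → Line → Set (c ⊔ ℓ)
  OnLine x L = ∃ λ t → x ≈ₚ (Line.base L ⊕ (t · Line.dir L))

  record Plane : Set (c ⊔ ℓ) where
    field
      base   : Point
      dir₁   : Point
      dir₂   : Point
      indep  : ∀ a b → ((a · dir₁) ⊕ (b · dir₂)) ≈ₚ 𝟎 → (a ≈ 0#) × (b ≈ 0#)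

  OnPlane : Point → Plane → Set (c ⊔ ℓ)
  OnPlane x P = ∃₂ λ s t →
    x ≈ₚ (Plane.base P ⊕ ((s · Plane.dir₁ P) ⊕ (t · Plane.dir₂ P)))

  PlaneContainsLine : Plane → Line → Set (c ⊔ ℓ)
  PlaneContainsLine P L = ∀ x → OnLine x L → OnPlane x P

  open SetoidMembership PointSetoid public using () renaming (_∈_ to _∈ₚ_)
  open SetoidUnique PointSetoid public using () renaming (Unique to Distinct)

-- If M avoids L, then L and M merge into a single sublist S of T with
-- |S| = |L| + |M|.  In (1), S lies on the pair of lines ℓ₀, m; in (2), on the
-- plane P ⊇ ℓ₀.  Either way |L| + |M| ≤ n′, and |L| ≥ n′ − k leaves |M| ≤ k.
module Submission where

open import Defs
open import Level using (Level)
open import Data.Nat using (ℕ; _≤_; _∸_; _+_; suc)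
open import Data.Nat.Properties using (≤-trans; ≤-reflexive; +-comm; +-suc; +-cancelˡ-≤; +-monoʳ-≤; m≤n+m∸n; module ≤-Reasoning)
open import Data.Sum using (_⊎_; inj₁; inj₂)
open import Data.List using (List; length; []; _∷_)
open import Data.List.Relation.Unary.All using (All; []; _∷_)
import Data.List.Relation.Unary.All as All
open import Data.List.Relation.Unary.Any using (here; there)
open import Data.List.Relation.Binary.Sublist.Propositional using (_⊆_; []; _∷_; _∷ʳ_)
import Data.List.Membership.Setoid as SetoidMembership
open import Relation.Binary.PropositionalEquality using (_≡_; refl; cong; sym; trans)
open import Relation.Binary.Bundles using (Setoid)
open import Relation.Nullary using (¬_)
open import Data.Product using (_×_; _,_; Σ)
open import Data.Empty using (⊥-elim)

module _ {a e} (A : Setoid a e) where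
  open Setoid A using (Carrier) renaming (refl to ≈-refl)
  open SetoidMembership A using (_∈_)

  merge-disjoint-⊆ : ∀ {p} (Q : Carrier → Set p) {T L M : List Carrier} →
                     L ⊆ T → M ⊆ T → All (λ x → ¬ (x ∈ L)) M → All Q L → All Q M →
                     Σ (List Carrier) λ S → S ⊆ T × length S ≡ length L + length M × All Q S
  merge-disjoint-⊆ Q [] [] [] [] [] = [] , [] , refl , []
  merge-disjoint-⊆ Q (y ∷ʳ L⊆T) (.y ∷ʳ M⊆T) M∉L QL QM
    with S , S⊆T , |S| , QS ← merge-disjoint-⊆ Q L⊆T M⊆T M∉L QL QM
    = S , y ∷ʳ S⊆T , |S| , QS
  merge-disjoint-⊆ Q (refl ∷ L⊆T) (_ ∷ʳ M⊆T) M∉L (Qx ∷ QL) QM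
    with S , S⊆T , |S| , QS ← merge-disjoint-⊆ Q L⊆T M⊆T (All.map (λ x∉x∷L x∈L → x∉x∷L (there x∈L)) M∉L) QL QM
    = _ , refl ∷ S⊆T , cong suc |S| , Qx ∷ QS
  merge-disjoint-⊆ Q {L = L} {M = _ ∷ M} (_ ∷ʳ L⊆T) (refl ∷ M⊆T) (_ ∷ M∉L) QL (Qx ∷ QM)
    with S , S⊆T , |S| , QS ← merge-disjoint-⊆ Q L⊆T M⊆T M∉L QL QM
    = _ , refl ∷ S⊆T , trans (cong suc |S|) (sym (+-suc (length L) (length M))) , Qx ∷ QS
  merge-disjoint-⊆ Q (refl ∷ _) (refl ∷ _) (x∉L ∷ _) _ _ = ⊥-elim (x∉L (here ≈-refl))

complement-bound : ∀ {n′ k l m : ℕ} → n′ ∸ k ≤ l → l + m ≤ n′ → m ≤ k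
complement-bound {n′} {k} {l} {m} n′∸k≤l l+m≤n′ = +-cancelˡ-≤ l m k (begin
  l + m         ≤⟨ l+m≤n′ ⟩
  n′            ≤⟨ m≤n+m∸n n′ k ⟩
  k + (n′ ∸ k)  ≤⟨ +-monoʳ-≤ k n′∸k≤l ⟩
  k + l         ≡⟨ +-comm k l ⟩
  l + k         ∎)
  where open ≤-Reasoning

lemma12 : ∀ {c ℓ : Level} (F : Field c ℓ) → let open Geometry F in
    (n n′ k : ℕ) (T : List Point) → Distinct T → length T ≡ n →
    (∀ (S : List Point) → S ⊆ T → (P : Plane) → All (λ x → OnPlane x P) S → length S ≤ n′) →
    (∀ (S : List Point) → S ⊆ T → (ℓ₁ ℓ₂ : Line) → All (λ x → OnLine x ℓ₁ ⊎ OnLine x ℓ₂) S → length S ≤ n′) →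
    (L : List Point) → L ⊆ T → n′ ∸ k ≤ length L → (ℓ₀ : Line) → All (λ x → OnLine x ℓ₀) L →
    (∀ (M : List Point) → M ⊆ T → All (λ x → ¬ (x ∈ₚ L)) M → (m : Line) → All (λ x → OnLine x m) M → length M ≤ k)
    × (∀ (M : List Point) → M ⊆ T → All (λ x → ¬ (x ∈ₚ L)) M → (P : Plane) → PlaneContainsLine P ℓ₀ → All (λ x → OnPlane x P) M → length M ≤ k)
lemma12 F n n′ k T _ _ planeBound linePairBound L L⊆T |L|≥n′∸k ℓ₀ L-on-ℓ₀ = collinear , coplanar
  where
  open Geometry F

  collinear : ∀ M → M ⊆ T → All (λ x → ¬ (x ∈ₚ L)) M → (m : Line) → All (λ x → OnLine x m) M → length M ≤ k
  collinear M M⊆T M∉L m M-on-m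
    with S , S⊆T , |S| , S-on-lines ←
         merge-disjoint-⊆ PointSetoid _ L⊆T M⊆T M∉L (All.map inj₁ L-on-ℓ₀) (All.map inj₂ M-on-m)
    = complement-bound |L|≥n′∸k (≤-trans (≤-reflexive (sym |S|)) (linePairBound S S⊆T ℓ₀ m S-on-lines))

  coplanar : ∀ M → M ⊆ T → All (λ x → ¬ (x ∈ₚ L)) M → (P : Plane) → PlaneContainsLine P ℓ₀ → All (λ x → OnPlane x P) M → length M ≤ k
  coplanar M M⊆T M∉L P P⊇ℓ₀ M-on-P
    with S , S⊆T , |S| , S-on-P ←
         merge-disjoint-⊆ PointSetoid _ L⊆T M⊆T M∉L (All.map (P⊇ℓ₀ _) L-on-ℓ₀) M-on-P
    = complement-bound |L|≥n′∸k (≤-trans (≤-reflexive (sym |S|)) (planeBound S S⊆T P S-on-P))
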